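{- Let $P$ be a signed path with negative sections of odd length $N_1,\dots,N_k$ ($k\ge 0$), in order along $P$. Let $Q_0$ be the subpath preceding $N_1$ (possibly of length $0$), $Q_i$ the subpath between $N_i$ and $N_{i+1}$ for $1\le i\le k-1$, and $Q_k$ the subpath following $N_k$ (possibly of length $0$); when $k=0$, $Q_0=P$. Let $m_i$ be the number of positive edges in $Q_i$, $m_o=\sum_{i\text{ odd}}m_i$ and $m_e=\sum_{i\text{ even}}m_i$. Then $P$ is a parity signed graph if and only if $m_e-m_o\in\{1,0,-1\}$ when $k$ is odd, and $m_e-m_o\in\{0,-1,-2\}$ when $k$ is even. In particular, if $P$ has no odd negative sections, it is parity signed if and only if it has no positive edges; if $P$ has exactly one odd negative section, it is parity signed if and only if the numbers of positive edges on the two sides of that section differ by at most $1$.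
   Context: A signed graph is a pair $S=(G,\sigma)$ with $G$ a graph and $\sigma:E(G)\to\{+,-\}$. For a graph $G$ with $n$ vertices and a bijection $f:V(G)\to\{1,\dots,n\}$, define $\sigma_f(uv)=+$ if $f(u),f(v)$ have the same parity and $\sigma_f(uv)=-$ otherwise. $S$ is a parity signed graph if $\sigma=\sigma_f$ for some such bijection $f$. A positive (negative) section is a maximal connected subgraph all of whose edges are positive (negative); in a path each section is a subpath, called odd or even according to the parity of its length. -}

module Defs where

open import Data.Bool using (Bool; true; false; if_then_else_; _∧_)
open import Data.Nat using (ℕ; zero; suc; _%_; _≡ᵇ_; _+_)
open import Data.Fin using (Fin; toℕ; inject₁) renaming (suc to fsuc)
open import Data.List using (List; []; _∷_; length; lookup; replicate; _++_; filter; sum)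
open import Data.List.NonEmpty using (List⁺; _∷_; _∷⁺_; toList)
open import Data.Product using (Σ; _×_; _,_)
open import Data.Integer using (ℤ; _-_; +_)
open import Function.Definitions using (Bijective)
open import Relation.Binary.PropositionalEquality using (_≡_)
open import Relation.Nullary using (Dec; yes; no)

data Sign : Set where
  pos neg : Sign

-- A path with edge-sign list ss has  n = suc (length ss)  vertices 0,…,n-1
-- (as Fin n); edge i (i : Fin (length ss)) joins vertices inject₁ i and suc i.
SignedPath : Set
SignedPath = List Sign

nVert : SignedPath → ℕ
nVert ss = suc (length ss)

σ : ℕ → ℕ → Sign
σ a b = if (a % 2) ≡ᵇ (b % 2) then pos else neg

-- The label of a vertex under a bijection  f : Fin n → Fin n  is  1 + toℕ (f v) ∈ {1,…,n}.
label : {n : ℕ} → (Fin n → Fin n) → Fin n → ℕ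
label f v = suc (toℕ (f v))

ParitySigned : SignedPath → Set
ParitySigned ss =
  Σ (Fin (nVert ss) → Fin (nVert ss)) λ f →
    Bijective _≡_ _≡_ f ×
    ((i : Fin (length ss)) → lookup ss i ≡ σ (label f (inject₁ i)) (label f (fsuc i)))

-- Sections: maximal runs of equal sign, as (sign, length) with length ≥ 1, in order.
_≟s_ : (s t : Sign) → Bool
pos ≟s pos = true
neg ≟s neg = true
_   ≟s _   = false

sections : SignedPath → List (Sign × ℕ)
sections [] = []
sections (s ∷ ss) with sections ss
... | [] = (s , 1) ∷ []
... | (t , l) ∷ rest = if s ≟s t then (t , suc l) ∷ rest else (s , 1) ∷ (t , l) ∷ rest

isOdd : ℕ → Bool
isOdd n = (n % 2) ≡ᵇ 1

isOddNeg : Sign × ℕ → Bool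
isOddNeg (neg , l) = isOdd l
isOddNeg (pos , l) = false

-- Cut the path at its odd negative sections N₁,…,N_k: returns Q₀,…,Q_k
-- (as edge-sign lists, in order along P; Q's may be empty).
cutQ : List (Sign × ℕ) → List⁺ (List Sign)
cutQ [] = [] ∷ []
cutQ ((s , l) ∷ rest) with isOddNeg (s , l) | cutQ rest
... | true  | qs = [] ∷⁺ qs
... | false | q ∷ qs = (replicate l s ++ q) ∷ qs

Qs : SignedPath → List (List Sign)
Qs ss = toList (cutQ (sections ss))

oddNegCount : SignedPath → ℕ
oddNegCount ss = length (filter (λ x → isOddNeg x B.≟ true) (sections ss))
  where import Data.Bool as B

isPos : (s : Sign) → Dec (s ≡ pos)
isPos pos = yes _≡_.refl
isPos neg = no (λ ())

posCount : List Sign → ℕ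
posCount q = length (filter isPos q)

evenSum oddSum : List ℕ → ℕ
evenSum [] = 0
evenSum (x ∷ xs) = x + oddSum xs
oddSum [] = 0
oddSum (x ∷ xs) = evenSum xs

ms : SignedPath → List ℕ
ms ss = Data.List.map posCount (Qs ss)

mE mO : SignedPath → ℕ
mE ss = evenSum (ms ss)
mO ss = oddSum (ms ss)

diffEO : SignedPath → ℤ
diffEO ss = + mE ss - + mO ss

-- A labelling realises the signs of P exactly when the parities of the labels follow the signs
-- along P: a positive edge keeps the parity, a negative edge flips it.  So P determines the
-- parity pattern up to complement, and a bijection onto {1,…,n} with that pattern exists iff
-- one parity class has ⌈n/2⌉ vertices, i.e. iff the two classes differ in size by at most one.
-- The size of the class of the first vertex minus that of the other class, β, satisfies
-- β(+P) = 1 + β(P) and β(−P) = 1 − β(P), where ±P is P with an edge of that sign prepended.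
-- Read section by section, a positive section of length l adds l, an even negative section
-- changes nothing, and an odd negative section negates everything after it; hence
-- β(P) = 1 + (m_e − m_o) − [k odd].
module Submission where

open import Defs
import Algebra.Properties.CommutativeMonoid.Sum as MonoidSum
open import Data.Bool as Bool using (Bool; true; false; not; if_then_else_)
open import Data.Bool.Properties using (¬-not)
open import Data.Fin using (Fin; toℕ; inject₁; punchIn) renaming (zero to fzero; suc to fsuc)
open import Data.Fin.Permutation as Perm using (Permutation; _⟨$⟩ʳ_; insert; insert-punchIn)
open import Data.Fin.Properties using (any?)
open import Data.Integer as ℤ using (ℤ; +_; -_; -[1+_]; ∣_∣; _-_)
open import Data.Integer.Properties
  using (+-injective; neg-injective; pos-+; +-identityˡ; +-identityʳ; +-assoc)
open import Data.Integer.Tactic.RingSolver using (solve-∀)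
open import Data.List using (List; []; _∷_; length; lookup; replicate; _++_; filter; map)
open import Data.List.NonEmpty using (head; tail; toList)
open import Data.Nat as ℕ using (ℕ; zero; suc; _%_; _≤_; z≤n; s≤s; ⌊_/2⌋; ⌈_/2⌉)
open import Data.Nat.Properties
  using (+-0-commutativeMonoid; +-suc; +-comm; +-cancelˡ-≡; m≤m+n; 1+n≢0; 1+n≰n;
         ⌊n/2⌋+⌈n/2⌉≡n; n≡⌈n+n/2⌉; n≡⌊n+n/2⌋)
open import Data.Product using (Σ; ∃-syntax; _×_; _,_; proj₁; proj₂; map₁)
open import Data.Sum as Sum using (_⊎_; inj₁; inj₂)
open import Data.Sum.Function.Propositional using (_⊎-⇔_)
open import Function using (_∘_; _⇔_; mk⇔; Equivalence; Bijection)
open import Function.Bundles using (mk⤖)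
open import Function.Construct.Composition using (_⇔-∘_)
open import Function.Properties.Bijection using (⤖⇒↔)
open import Function.Properties.Inverse using (↔⇒⤖)
open import Function.Related.Propositional using (module EquationalReasoning)
open import Relation.Binary.PropositionalEquality
open import Relation.Nullary using (yes; no; contradiction)

open MonoidSum +-0-commutativeMonoid using (sum; sum-cong-≗; sum-remove; sum-permute)

-- Parity patterns of labellings

step : Sign → Bool → Bool
step pos b = b
step neg b = not b

agreement : Bool → Bool → Sign
agreement true  true  = pos
agreement false false = pos
agreement true  false = neg
agreement false true  = neg

agreement-step : ∀ s b → agreement b (step s b) ≡ s
agreement-step pos true  = refl
agreement-step pos false = refl
agreement-step neg true  = refl
agreement-step neg false = refl

step-agreement : ∀ b c → step (agreement b c) b ≡ c
step-agreement true  true  = refl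
step-agreement false false = refl
step-agreement true  false = refl
step-agreement false true  = refl

step-not : ∀ s b → step s (not b) ≡ not (step s b)
step-not pos b = refl
step-not neg b = refl

σ≡agreement : ∀ a b → σ a b ≡ agreement (isOdd a) (isOdd b)
σ≡agreement 0             0             = refl
σ≡agreement 0             1             = refl
σ≡agreement 0             (suc (suc b)) = σ≡agreement 0 b
σ≡agreement 1             0             = refl
σ≡agreement 1             1             = refl
σ≡agreement 1             (suc (suc b)) = σ≡agreement 1 b
σ≡agreement (suc (suc a)) b             = σ≡agreement a b

parities : Bool → (ss : SignedPath) → Fin (nVert ss) → Bool
parities b ss       fzero    = b
parities b []       (fsuc ())
parities b (s ∷ ss) (fsuc v) = parities (step s b) ss v

parities-not : ∀ b ss v → parities (not b) ss v ≡ not (parities b ss v)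
parities-not b ss       fzero    = refl
parities-not b (s ∷ ss) (fsuc v) =
  trans (cong (λ c → parities c ss v) (step-not s b)) (parities-not (step s b) ss v)

parities-agreement : ∀ b ss i →
  lookup ss i ≡ agreement (parities b ss (inject₁ i)) (parities b ss (fsuc i))
parities-agreement b (s ∷ ss) fzero    = sym (agreement-step s b)
parities-agreement b (s ∷ ss) (fsuc i) = parities-agreement (step s b) ss i

SignedBy : (ss : SignedPath) → (Fin (nVert ss) → ℕ) → Set
SignedBy ss g = ∀ i → lookup ss i ≡ σ (g (inject₁ i)) (g (fsuc i))

signedBy⇒parities : ∀ ss {g} → SignedBy ss g →
  ∀ v → isOdd (g v) ≡ parities (isOdd (g fzero)) ss v
signedBy⇒parities ss           signed fzero    = refl
signedBy⇒parities (s ∷ ss) {g} signed (fsuc v) =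
  trans (signedBy⇒parities ss {g ∘ fsuc} (signed ∘ fsuc) v) (cong (λ b → parities b ss v) g₁-parity)
  where
  g₀ g₁ : ℕ
  g₀ = g fzero
  g₁ = g (fsuc fzero)
  g₁-parity : isOdd g₁ ≡ step s (isOdd g₀)
  g₁-parity = trans (sym (step-agreement (isOdd g₀) (isOdd g₁)))
                    (cong (λ t → step t (isOdd g₀)) (sym (trans (signed fzero) (σ≡agreement g₀ g₁))))

parities⇒signedBy : ∀ ss b {g} → (∀ v → isOdd (g v) ≡ parities b ss v) → SignedBy ss g
parities⇒signedBy ss b {g} g≗ i = begin
  lookup ss i
    ≡⟨ parities-agreement b ss i ⟩
  agreement (parities b ss (inject₁ i)) (parities b ss (fsuc i))
    ≡⟨ cong₂ agreement (g≗ (inject₁ i)) (g≗ (fsuc i)) ⟨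
  agreement (isOdd (g (inject₁ i))) (isOdd (g (fsuc i)))
    ≡⟨ σ≡agreement (g (inject₁ i)) (g (fsuc i)) ⟨
  σ (g (inject₁ i)) (g (fsuc i))
    ∎
  where open ≡-Reasoning

-- Realising a parity pattern by a bijection

𝟙 : Bool → ℕ
𝟙 b = if b then 1 else 0

trueCount : ∀ {n} → (Fin n → Bool) → ℕ
trueCount p = sum (𝟙 ∘ p)

trueCount-cong : ∀ {n} {p q : Fin n → Bool} → (∀ i → p i ≡ q i) → trueCount p ≡ trueCount q
trueCount-cong p≗q = sum-cong-≗ (cong 𝟙 ∘ p≗q)

trueCount-not : ∀ {n} (p : Fin n → Bool) → trueCount p ℕ.+ trueCount (not ∘ p) ≡ n
trueCount-not {zero}  p = refl
trueCount-not {suc n} p = add (p fzero) (trueCount-not (p ∘ fsuc))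
  where
  add : ∀ b {t f} → t ℕ.+ f ≡ n →
        𝟙 b ℕ.+ t ℕ.+ (𝟙 (not b) ℕ.+ f) ≡ suc n
  add true  e = cong suc e
  add false e = trans (+-suc _ _) (cong suc e)

trueCount-≤ : ∀ {n} (p : Fin n → Bool) → trueCount p ≤ n
trueCount-≤ p = subst (trueCount p ≤_) (trueCount-not p) (m≤m+n _ _)

trueCount-true : ∀ n → trueCount {n} (λ _ → true) ≡ n
trueCount-true zero    = refl
trueCount-true (suc n) = cong suc (trueCount-true n)

trueCount-false : ∀ n → trueCount {n} (λ _ → false) ≡ 0
trueCount-false zero    = refl
trueCount-false (suc n) = trueCount-false n

trueCount-≢-const-not : ∀ {n} b (p : Fin n → Bool) →
  𝟙 b ℕ.+ trueCount p ≢ trueCount {suc n} (λ _ → not b)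
trueCount-≢-const-not {n} true  p e = 1+n≢0 (trans e (trueCount-false n))
trueCount-≢-const-not {n} false p e =
  1+n≰n (subst (_≤ n) (trans e (cong suc (trueCount-true n))) (trueCount-≤ p))

trueCount≡⇒∃-permutation : ∀ {n} (p q : Fin n → Bool) → trueCount p ≡ trueCount q →
  Σ (Permutation n n) λ π → ∀ i → q (π ⟨$⟩ʳ i) ≡ p i
trueCount≡⇒∃-permutation {zero}  p q _  = Perm.id , λ ()
trueCount≡⇒∃-permutation {suc n} p q eq with any? (λ j → q j Bool.≟ p fzero)
... | no noMatch =
  contradiction (trans eq (trueCount-cong (λ j → ¬-not (λ e → noMatch (j , e)))))
                (trueCount-≢-const-not (p fzero) (p ∘ fsuc))
... | yes (j , qj≡p₀) = insert fzero j π , matched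
  where
  open ≡-Reasoning
  restEq : trueCount (p ∘ fsuc) ≡ trueCount (q ∘ punchIn j)
  restEq = +-cancelˡ-≡ (𝟙 (p fzero)) _ _ (begin
    trueCount p                                  ≡⟨ eq ⟩
    trueCount q                                  ≡⟨ sum-remove {i = j} (𝟙 ∘ q) ⟩
    𝟙 (q j) ℕ.+ trueCount (q ∘ punchIn j)        ≡⟨ cong (λ b → 𝟙 b ℕ.+ _) qj≡p₀ ⟩
    𝟙 (p fzero) ℕ.+ trueCount (q ∘ punchIn j)    ∎)
  rest = trueCount≡⇒∃-permutation (p ∘ fsuc) (q ∘ punchIn j) restEq
  π = proj₁ rest
  matched : ∀ i → q (insert fzero j π ⟨$⟩ʳ i) ≡ p i
  matched fzero    = qj≡p₀
  matched (fsuc i) = trans (cong q (insert-punchIn fzero j π i)) (proj₂ rest i)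

labelParity : ∀ {n} → Fin n → Bool
labelParity i = isOdd (suc (toℕ i))

paritySigned⇔∃-trueCount : ∀ ss →
  ParitySigned ss ⇔ (∃[ b ] trueCount (parities b ss) ≡ trueCount (labelParity {nVert ss}))
paritySigned⇔∃-trueCount ss = mk⇔ to from
  where
  n = nVert ss
  to : ParitySigned ss → ∃[ b ] trueCount (parities b ss) ≡ trueCount (labelParity {n})
  to (f , bij , signed) = isOdd (label f fzero) , (begin
    trueCount (parities (isOdd (label f fzero)) ss)
      ≡⟨ trueCount-cong (signedBy⇒parities ss {label f} signed) ⟨
    trueCount (labelParity ∘ f)
      ≡⟨ sum-permute (𝟙 ∘ labelParity) π ⟨
    trueCount (labelParity {n})
      ∎)
    where
    open ≡-Reasoning
    π : Permutation n n
    π = ⤖⇒↔ (mk⤖ bij)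
  from : ∃[ b ] trueCount (parities b ss) ≡ trueCount (labelParity {n}) → ParitySigned ss
  from (b , e) =
    (π ⟨$⟩ʳ_) , Bijection.bijective (↔⇒⤖ π) , parities⇒signedBy ss b {label (π ⟨$⟩ʳ_)} (proj₂ matching)
    where
    matching = trueCount≡⇒∃-permutation (parities b ss) labelParity e
    π = proj₁ matching

trueCount-isOdd : ∀ n → trueCount (λ (i : Fin n) → isOdd (toℕ i)) ≡ ⌊ n /2⌋
trueCount-labelParity : ∀ n → trueCount (labelParity {n}) ≡ ⌈ n /2⌉
trueCount-isOdd zero          = refl
trueCount-isOdd (suc n)       = trueCount-labelParity n
trueCount-labelParity zero    = refl
trueCount-labelParity (suc n) = cong suc (trueCount-isOdd n)

-- Balanced parity classes

∃-Bool⇔ : {P : Bool → Set} → (∃[ b ] P b) ⇔ (P true ⊎ P false)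
∃-Bool⇔ = mk⇔ (λ { (true , p) → inj₁ p ; (false , p) → inj₂ p })
              (λ { (inj₁ p) → true , p ; (inj₂ p) → false , p })

⌈n/2⌉≡⌊n/2⌋⊎⌈n/2⌉≡1+⌊n/2⌋ : ∀ n → ⌈ n /2⌉ ≡ ⌊ n /2⌋ ⊎ ⌈ n /2⌉ ≡ suc ⌊ n /2⌋
⌈n/2⌉≡⌊n/2⌋⊎⌈n/2⌉≡1+⌊n/2⌋ zero = inj₁ refl
⌈n/2⌉≡⌊n/2⌋⊎⌈n/2⌉≡1+⌊n/2⌋ (suc n) with ⌈n/2⌉≡⌊n/2⌋⊎⌈n/2⌉≡1+⌊n/2⌋ n
... | inj₁ e = inj₂ (cong suc (sym e))
... | inj₂ e = inj₁ (sym e)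

m≡⌈m+n/2⌉⇔ : ∀ m n → m ≡ ⌈ m ℕ.+ n /2⌉ ⇔ (m ≡ n ⊎ m ≡ suc n)
m≡⌈m+n/2⌉⇔ m n = mk⇔ to from
  where
  k = m ℕ.+ n
  to : m ≡ ⌈ k /2⌉ → m ≡ n ⊎ m ≡ suc n
  to m≡⌈k/2⌉ = Sum.map (λ e → trans m≡⌈k/2⌉ (trans e (sym n≡⌊k/2⌋)))
                       (λ e → trans m≡⌈k/2⌉ (trans e (cong suc (sym n≡⌊k/2⌋))))
                       (⌈n/2⌉≡⌊n/2⌋⊎⌈n/2⌉≡1+⌊n/2⌋ k)
    where
    open ≡-Reasoning
    n≡⌊k/2⌋ : n ≡ ⌊ k /2⌋
    n≡⌊k/2⌋ = +-cancelˡ-≡ m _ _ (begin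
      m ℕ.+ n               ≡⟨ ⌊n/2⌋+⌈n/2⌉≡n k ⟨
      ⌊ k /2⌋ ℕ.+ ⌈ k /2⌉   ≡⟨ +-comm ⌊ k /2⌋ ⌈ k /2⌉ ⟩
      ⌈ k /2⌉ ℕ.+ ⌊ k /2⌋   ≡⟨ cong (ℕ._+ ⌊ k /2⌋) m≡⌈k/2⌉ ⟨
      m ℕ.+ ⌊ k /2⌋         ∎)
  from : m ≡ n ⊎ m ≡ suc n → m ≡ ⌈ k /2⌉
  from (inj₁ refl) = n≡⌈n+n/2⌉ m
  from (inj₂ refl) = cong suc (n≡⌊n+n/2⌋ n)

Balanced : ℕ → ℕ → Set
Balanced m n = m ≡ suc n ⊎ m ≡ n ⊎ n ≡ suc m

halves⇔balanced : ∀ m n → (m ≡ ⌈ m ℕ.+ n /2⌉ ⊎ n ≡ ⌈ m ℕ.+ n /2⌉) ⇔ Balanced m n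
halves⇔balanced m n = mk⇔ to from
  where
  n≡⌈m+n/2⌉⇔ : n ≡ ⌈ m ℕ.+ n /2⌉ ⇔ (n ≡ m ⊎ n ≡ suc m)
  n≡⌈m+n/2⌉⇔ = subst (λ k → n ≡ ⌈ k /2⌉ ⇔ (n ≡ m ⊎ n ≡ suc m)) (+-comm n m) (m≡⌈m+n/2⌉⇔ n m)
  to : m ≡ ⌈ m ℕ.+ n /2⌉ ⊎ n ≡ ⌈ m ℕ.+ n /2⌉ → Balanced m n
  to (inj₁ e) with Equivalence.to (m≡⌈m+n/2⌉⇔ m n) e
  ... | inj₁ m≡n   = inj₂ (inj₁ m≡n)
  ... | inj₂ m≡1+n = inj₁ m≡1+n
  to (inj₂ e) with Equivalence.to n≡⌈m+n/2⌉⇔ e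
  ... | inj₁ n≡m   = inj₂ (inj₁ (sym n≡m))
  ... | inj₂ n≡1+m = inj₂ (inj₂ n≡1+m)
  from : Balanced m n → m ≡ ⌈ m ℕ.+ n /2⌉ ⊎ n ≡ ⌈ m ℕ.+ n /2⌉
  from (inj₁ m≡1+n)        = inj₁ (Equivalence.from (m≡⌈m+n/2⌉⇔ m n) (inj₂ m≡1+n))
  from (inj₂ (inj₁ m≡n))   = inj₁ (Equivalence.from (m≡⌈m+n/2⌉⇔ m n) (inj₁ m≡n))
  from (inj₂ (inj₂ n≡1+m)) = inj₂ (Equivalence.from n≡⌈m+n/2⌉⇔ (inj₂ n≡1+m))

WithinOne : ℤ → Set
WithinOne z = z ≡ + 1 ⊎ z ≡ + 0 ⊎ z ≡ - (+ 1)

m≡k+n⇔m-n≡k : ∀ m n k → m ≡ k ℕ.+ n ⇔ + m - + n ≡ + k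
m≡k+n⇔m-n≡k m n k = mk⇔ to from
  where
  open ≡-Reasoning
  to : m ≡ k ℕ.+ n → + m - + n ≡ + k
  to refl = trans (cong (_- + n) (pos-+ k n)) (x+y-y≡x (+ k) (+ n))
    where
    x+y-y≡x : ∀ x y → x ℤ.+ y - y ≡ x
    x+y-y≡x = solve-∀
  from : + m - + n ≡ + k → m ≡ k ℕ.+ n
  from e = +-injective (begin
    + m                  ≡⟨ x-y+y≡x (+ m) (+ n) ⟨
    + m - + n ℤ.+ + n    ≡⟨ cong (ℤ._+ + n) e ⟩
    + k ℤ.+ + n          ≡⟨ pos-+ k n ⟨
    + (k ℕ.+ n)          ∎)
    where
    x-y+y≡x : ∀ x y → x - y ℤ.+ y ≡ x
    x-y+y≡x = solve-∀

x-y≡z⇔y-x≡-z : ∀ x y z → x - y ≡ z ⇔ y - x ≡ - z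
x-y≡z⇔y-x≡-z x y z = mk⇔ (λ e → trans (y-x≡-[x-y] x y) (cong -_ e))
                         (λ e → neg-injective (trans (sym (y-x≡-[x-y] x y)) e))
  where
  y-x≡-[x-y] : ∀ x y → y - x ≡ - (x - y)
  y-x≡-[x-y] = solve-∀

balanced⇔withinOne : ∀ m n → Balanced m n ⇔ WithinOne (+ m - + n)
balanced⇔withinOne m n =
  m≡k+n⇔m-n≡k m n 1 ⊎-⇔
  m≡k+n⇔m-n≡k m n 0 ⊎-⇔
  (x-y≡z⇔y-x≡-z (+ n) (+ m) (+ 1) ⇔-∘ m≡k+n⇔m-n≡k n m 1)

balance : SignedPath → ℤ
balance []         = + 1
balance (pos ∷ ss) = + 1 ℤ.+ balance ss
balance (neg ∷ ss) = + 1 - balance ss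

trueCount-parities : ∀ ss →
  + trueCount (parities true ss) - + trueCount (parities false ss) ≡ balance ss
trueCount-parities []         = refl
trueCount-parities (pos ∷ ss) = begin
  + suc t - + f               ≡⟨ cong (_- + f) (pos-+ 1 t) ⟩
  + 1 ℤ.+ + t - + f           ≡⟨ 1+x-y≡1+[x-y] (+ t) (+ f) ⟩
  + 1 ℤ.+ (+ t - + f)         ≡⟨ cong (λ x → + 1 ℤ.+ x) (trueCount-parities ss) ⟩
  + 1 ℤ.+ balance ss          ∎
  where
  open ≡-Reasoning
  t = trueCount (parities true ss)
  f = trueCount (parities false ss)
  1+x-y≡1+[x-y] : ∀ x y → + 1 ℤ.+ x - y ≡ + 1 ℤ.+ (x - y)
  1+x-y≡1+[x-y] = solve-∀
trueCount-parities (neg ∷ ss) = begin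
  + suc f - + t               ≡⟨ cong (_- + t) (pos-+ 1 f) ⟩
  + 1 ℤ.+ + f - + t           ≡⟨ 1+y-x≡1-[x-y] (+ t) (+ f) ⟩
  + 1 - (+ t - + f)           ≡⟨ cong (λ x → + 1 - x) (trueCount-parities ss) ⟩
  + 1 - balance ss            ∎
  where
  open ≡-Reasoning
  t = trueCount (parities true ss)
  f = trueCount (parities false ss)
  1+y-x≡1-[x-y] : ∀ x y → + 1 ℤ.+ y - x ≡ + 1 - (x - y)
  1+y-x≡1-[x-y] = solve-∀

paritySigned⇔withinOne-balance : ∀ ss → ParitySigned ss ⇔ WithinOne (balance ss)
paritySigned⇔withinOne-balance ss = begin
  ParitySigned ss
    ∼⟨ paritySigned⇔∃-trueCount ss ⟩
  (∃[ b ] trueCount (parities b ss) ≡ trueCount (labelParity {n}))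
    ≡⟨ cong (λ c → ∃[ b ] trueCount (parities b ss) ≡ c) (trueCount-labelParity n) ⟩
  (∃[ b ] trueCount (parities b ss) ≡ ⌈ n /2⌉)
    ∼⟨ ∃-Bool⇔ ⟩
  (t ≡ ⌈ n /2⌉ ⊎ f ≡ ⌈ n /2⌉)
    ≡⟨ cong (λ k → t ≡ ⌈ k /2⌉ ⊎ f ≡ ⌈ k /2⌉) t+f≡n ⟨
  (t ≡ ⌈ t ℕ.+ f /2⌉ ⊎ f ≡ ⌈ t ℕ.+ f /2⌉)
    ∼⟨ halves⇔balanced t f ⟩
  Balanced t f
    ∼⟨ balanced⇔withinOne t f ⟩
  WithinOne (+ t - + f)
    ≡⟨ cong WithinOne (trueCount-parities ss) ⟩
  WithinOne (balance ss)
    ∎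
  where
  open EquationalReasoning
  n = nVert ss
  t = trueCount (parities true ss)
  f = trueCount (parities false ss)
  t+f≡n : t ℕ.+ f ≡ n
  t+f≡n = trans (cong (t ℕ.+_) (trueCount-cong (parities-not true ss)))
                (trueCount-not (parities true ss))

-- The balance of a path, section by section

expand : List (Sign × ℕ) → SignedPath
expand []               = []
expand ((s , l) ∷ secs) = replicate l s ++ expand secs

expand-sections : ∀ ss → expand (sections ss) ≡ ss
expand-sections [] = refl
expand-sections (s ∷ ss) with sections ss | expand-sections ss
... | []                                      | e = cong (s ∷_) e
expand-sections (pos ∷ ss) | (pos , l) ∷ rest | e = cong (pos ∷_) e
expand-sections (pos ∷ ss) | (neg , l) ∷ rest | e = cong (pos ∷_) e
expand-sections (neg ∷ ss) | (pos , l) ∷ rest | e = cong (neg ∷_) e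
expand-sections (neg ∷ ss) | (neg , l) ∷ rest | e = cong (neg ∷_) e

balance-++-pos : ∀ l ss → balance (replicate l pos ++ ss) ≡ + l ℤ.+ balance ss
balance-++-pos zero    ss = sym (+-identityˡ (balance ss))
balance-++-pos (suc l) ss = begin
  + 1 ℤ.+ balance (replicate l pos ++ ss)   ≡⟨ cong (λ x → + 1 ℤ.+ x) (balance-++-pos l ss) ⟩
  + 1 ℤ.+ (+ l ℤ.+ balance ss)              ≡⟨ +-assoc (+ 1) (+ l) (balance ss) ⟨
  + 1 ℤ.+ + l ℤ.+ balance ss                ≡⟨ cong (ℤ._+ balance ss) (pos-+ 1 l) ⟨
  + suc l ℤ.+ balance ss                    ∎
  where open ≡-Reasoning

balance-++-neg : ∀ l ss →
  balance (replicate l neg ++ ss) ≡ (if isOdd l then + 1 - balance ss else balance ss)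
balance-++-neg zero          ss = refl
balance-++-neg (suc zero)    ss = refl
balance-++-neg (suc (suc l)) ss =
  trans (1-[1-x]≡x (balance (replicate l neg ++ ss))) (balance-++-neg l ss)
  where
  1-[1-x]≡x : ∀ x → + 1 - (+ 1 - x) ≡ x
  1-[1-x]≡x = solve-∀

posCount-++-pos : ∀ l q → posCount (replicate l pos ++ q) ≡ l ℕ.+ posCount q
posCount-++-pos zero    q = refl
posCount-++-pos (suc l) q = cong suc (posCount-++-pos l q)

posCount-++-neg : ∀ l q → posCount (replicate l neg ++ q) ≡ posCount q
posCount-++-neg zero    q = refl
posCount-++-neg (suc l) q = posCount-++-neg l q

alternatingSum : List ℕ → ℤ
alternatingSum []       = + 0
alternatingSum (m ∷ ms) = + m - alternatingSum ms

evenSum-oddSum : ∀ ms → + evenSum ms - + oddSum ms ≡ alternatingSum ms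
evenSum-oddSum []       = refl
evenSum-oddSum (m ∷ ms) = begin
  + (m ℕ.+ oddSum ms) - + evenSum ms   ≡⟨ cong (_- + evenSum ms) (pos-+ m (oddSum ms)) ⟩
  + m ℤ.+ + oddSum ms - + evenSum ms   ≡⟨ x+o-e≡x-[e-o] (+ m) (+ oddSum ms) (+ evenSum ms) ⟩
  + m - (+ evenSum ms - + oddSum ms)   ≡⟨ cong (λ x → + m - x) (evenSum-oddSum ms) ⟩
  + m - alternatingSum ms              ∎
  where
  open ≡-Reasoning
  x+o-e≡x-[e-o] : ∀ x o e → x ℤ.+ o - e ≡ x - (e - o)
  x+o-e≡x-[e-o] = solve-∀

oddNegSections : List (Sign × ℕ) → ℕ
oddNegSections secs = length (filter (λ x → isOddNeg x Bool.≟ true) secs)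

positiveCounts : List (Sign × ℕ) → List ℕ
positiveCounts secs = map posCount (toList (cutQ secs))

+[1+k%2]≡1-+[k%2] : ∀ k → + (suc k % 2) ≡ + 1 - + (k % 2)
+[1+k%2]≡1-+[k%2] zero          = refl
+[1+k%2]≡1-+[k%2] (suc zero)    = refl
+[1+k%2]≡1-+[k%2] (suc (suc k)) = +[1+k%2]≡1-+[k%2] k

balance-expand : ∀ secs →
  balance (expand secs) ≡ + 1 ℤ.+ alternatingSum (positiveCounts secs) - + (oddNegSections secs % 2)
balance-expand [] = refl
balance-expand ((pos , l) ∷ r) = begin
  balance (replicate l pos ++ expand r)
    ≡⟨ balance-++-pos l (expand r) ⟩
  + l ℤ.+ balance (expand r)
    ≡⟨ cong (λ x → + l ℤ.+ x) (balance-expand r) ⟩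
  + l ℤ.+ (+ 1 ℤ.+ (+ m - a) - δ)
    ≡⟨ rearrange (+ l) (+ m) a δ ⟩
  + 1 ℤ.+ (+ l ℤ.+ + m - a) - δ
    ≡⟨ cong (λ x → + 1 ℤ.+ (x - a) - δ) (pos-+ l m) ⟨
  + 1 ℤ.+ (+ (l ℕ.+ m) - a) - δ
    ≡⟨ cong (λ x → + 1 ℤ.+ (+ x - a) - δ) (posCount-++-pos l q) ⟨
  + 1 ℤ.+ (+ posCount (replicate l pos ++ q) - a) - δ
    ∎
  where
  open ≡-Reasoning
  q = head (cutQ r)
  m = posCount q
  a = alternatingSum (map posCount (tail (cutQ r)))
  δ = + (oddNegSections r % 2)
  rearrange : ∀ l m a δ → l ℤ.+ (+ 1 ℤ.+ (m - a) - δ) ≡ + 1 ℤ.+ (l ℤ.+ m - a) - δ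
  rearrange = solve-∀
balance-expand ((neg , l) ∷ r) with isOdd l | balance-++-neg l (expand r)
... | false | eq = begin
  balance (replicate l neg ++ expand r)
    ≡⟨ eq ⟩
  balance (expand r)
    ≡⟨ balance-expand r ⟩
  + 1 ℤ.+ (+ posCount q - a) - δ
    ≡⟨ cong (λ x → + 1 ℤ.+ (+ x - a) - δ) (posCount-++-neg l q) ⟨
  + 1 ℤ.+ (+ posCount (replicate l neg ++ q) - a) - δ
    ∎
  where
  open ≡-Reasoning
  q = head (cutQ r)
  a = alternatingSum (map posCount (tail (cutQ r)))
  δ = + (oddNegSections r % 2)
... | true | eq = begin
  balance (replicate l neg ++ expand r)
    ≡⟨ eq ⟩
  + 1 - balance (expand r)
    ≡⟨ cong (λ x → + 1 - x) (balance-expand r) ⟩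
  + 1 - (+ 1 ℤ.+ a - δ)
    ≡⟨ rearrange a δ ⟩
  + 1 ℤ.+ (+ 0 - a) - (+ 1 - δ)
    ≡⟨ cong (λ x → + 1 ℤ.+ (+ 0 - a) - x) (+[1+k%2]≡1-+[k%2] k) ⟨
  + 1 ℤ.+ (+ 0 - a) - + (suc k % 2)
    ∎
  where
  open ≡-Reasoning
  a = alternatingSum (positiveCounts r)
  k = oddNegSections r
  δ = + (k % 2)
  rearrange : ∀ a δ → + 1 - (+ 1 ℤ.+ a - δ) ≡ + 1 ℤ.+ (+ 0 - a) - (+ 1 - δ)
  rearrange = solve-∀

balance≡1+diffEO-k%2 : ∀ P → balance P ≡ + 1 ℤ.+ diffEO P - + (oddNegCount P % 2)
balance≡1+diffEO-k%2 P = begin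
  balance P                            ≡⟨ cong balance (expand-sections P) ⟨
  balance (expand (sections P))        ≡⟨ balance-expand (sections P) ⟩
  + 1 ℤ.+ alternatingSum (ms P) - δ    ≡⟨ cong (λ x → + 1 ℤ.+ x - δ) (evenSum-oddSum (ms P)) ⟨
  + 1 ℤ.+ diffEO P - δ                 ∎
  where
  open ≡-Reasoning
  δ = + (oddNegCount P % 2)

paritySigned⇔withinOne : ∀ P →
  ParitySigned P ⇔ WithinOne (+ 1 ℤ.+ diffEO P - + (oddNegCount P % 2))
paritySigned⇔withinOne P =
  subst (λ z → ParitySigned P ⇔ WithinOne z) (balance≡1+diffEO-k%2 P) (paritySigned⇔withinOne-balance P)

x+y≡z⇔y≡z-x : ∀ x y z → x ℤ.+ y ≡ z ⇔ y ≡ z - x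
x+y≡z⇔y≡z-x x y z = mk⇔ (λ { refl → sym (x+y-x≡y x y) }) (λ { refl → x+[z-x]≡z x z })
  where
  x+y-x≡y : ∀ x y → x ℤ.+ y - x ≡ y
  x+y-x≡y = solve-∀
  x+[z-x]≡z : ∀ x z → x ℤ.+ (z - x) ≡ z
  x+[z-x]≡z = solve-∀

withinOne-1+ : ∀ d → WithinOne (+ 1 ℤ.+ d) ⇔ (d ≡ + 0 ⊎ d ≡ - (+ 1) ⊎ d ≡ - (+ 2))
withinOne-1+ d =
  x+y≡z⇔y≡z-x (+ 1) d (+ 1) ⊎-⇔ x+y≡z⇔y≡z-x (+ 1) d (+ 0) ⊎-⇔ x+y≡z⇔y≡z-x (+ 1) d (- (+ 1))

withinOne⇔∣∣≤1 : ∀ z → WithinOne z ⇔ ∣ z ∣ ≤ 1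
withinOne⇔∣∣≤1 z = mk⇔ to (from z)
  where
  to : WithinOne z → ∣ z ∣ ≤ 1
  to (inj₁ refl)        = s≤s z≤n
  to (inj₂ (inj₁ refl)) = z≤n
  to (inj₂ (inj₂ refl)) = s≤s z≤n
  from : ∀ z → ∣ z ∣ ≤ 1 → WithinOne z
  from (+ zero)        _        = inj₂ (inj₁ refl)
  from (+ suc zero)    _        = inj₁ refl
  from (+ suc (suc n)) (s≤s ())
  from -[1+ zero ]     _        = inj₂ (inj₂ refl)
  from -[1+ suc n ]    (s≤s ())

paritySigned⇔-odd : ∀ P → oddNegCount P % 2 ≡ 1 → ParitySigned P ⇔ WithinOne (diffEO P)
paritySigned⇔-odd P k%2≡1 = begin
  ParitySigned P
    ∼⟨ paritySigned⇔withinOne P ⟩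
  WithinOne (+ 1 ℤ.+ diffEO P - + (oddNegCount P % 2))
    ≡⟨ cong (λ r → WithinOne (+ 1 ℤ.+ diffEO P - + r)) k%2≡1 ⟩
  WithinOne (+ 1 ℤ.+ diffEO P - + 1)
    ≡⟨ cong WithinOne (1+x-1≡x (diffEO P)) ⟩
  WithinOne (diffEO P)
    ∎
  where
  open EquationalReasoning
  1+x-1≡x : ∀ x → + 1 ℤ.+ x - + 1 ≡ x
  1+x-1≡x = solve-∀

paritySigned⇔-even : ∀ P → oddNegCount P % 2 ≡ 0 →
  ParitySigned P ⇔ (diffEO P ≡ + 0 ⊎ diffEO P ≡ - (+ 1) ⊎ diffEO P ≡ - (+ 2))
paritySigned⇔-even P k%2≡0 = begin
  ParitySigned P
    ∼⟨ paritySigned⇔withinOne P ⟩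
  WithinOne (+ 1 ℤ.+ diffEO P - + (oddNegCount P % 2))
    ≡⟨ cong (λ r → WithinOne (+ 1 ℤ.+ diffEO P - + r)) k%2≡0 ⟩
  WithinOne (+ 1 ℤ.+ diffEO P - + 0)
    ≡⟨ cong WithinOne (+-identityʳ (+ 1 ℤ.+ diffEO P)) ⟩
  WithinOne (+ 1 ℤ.+ diffEO P)
    ∼⟨ withinOne-1+ (diffEO P) ⟩
  (diffEO P ≡ + 0 ⊎ diffEO P ≡ - (+ 1) ⊎ diffEO P ≡ - (+ 2))
    ∎
  where open EquationalReasoning

cutQ-noOddNeg : ∀ secs → oddNegSections secs ≡ 0 →
  head (cutQ secs) ≡ expand secs × tail (cutQ secs) ≡ []
cutQ-noOddNeg []              _   = refl , refl
cutQ-noOddNeg ((pos , l) ∷ r) k≡0 = map₁ (cong (replicate l pos ++_)) (cutQ-noOddNeg r k≡0)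
cutQ-noOddNeg ((neg , l) ∷ r) k≡0 with isOdd l
... | false = map₁ (cong (replicate l neg ++_)) (cutQ-noOddNeg r k≡0)
cutQ-noOddNeg ((neg , l) ∷ r) () | true

diffEO-noOddNeg : ∀ P → oddNegCount P ≡ 0 → diffEO P ≡ + posCount P
diffEO-noOddNeg P k≡0 = begin
  diffEO P
    ≡⟨ evenSum-oddSum (ms P) ⟩
  alternatingSum (ms P)
    ≡⟨ cong₂ (λ q qs → alternatingSum (posCount q ∷ map posCount qs)) head≡ tail≡ ⟩
  + posCount (expand (sections P)) - + 0
    ≡⟨ +-identityʳ _ ⟩
  + posCount (expand (sections P))
    ≡⟨ cong (+_ ∘ posCount) (expand-sections P) ⟩
  + posCount P
    ∎
  where
  open ≡-Reasoning
  head≡ = proj₁ (cutQ-noOddNeg (sections P) k≡0)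
  tail≡ = proj₂ (cutQ-noOddNeg (sections P) k≡0)

paritySigned⇔-noOddNeg : ∀ P → oddNegCount P ≡ 0 → ParitySigned P ⇔ (posCount P ≡ 0)
paritySigned⇔-noOddNeg P k≡0 = begin
  ParitySigned P
    ∼⟨ paritySigned⇔-even P (cong (_% 2) k≡0) ⟩
  (diffEO P ≡ + 0 ⊎ diffEO P ≡ - (+ 1) ⊎ diffEO P ≡ - (+ 2))
    ≡⟨ cong (λ d → d ≡ + 0 ⊎ d ≡ - (+ 1) ⊎ d ≡ - (+ 2)) (diffEO-noOddNeg P k≡0) ⟩
  (+ m ≡ + 0 ⊎ + m ≡ - (+ 1) ⊎ + m ≡ - (+ 2))
    ∼⟨ mk⇔ (λ { (inj₁ e) → +-injective e ; (inj₂ (inj₁ ())) ; (inj₂ (inj₂ ())) })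
           (λ e → inj₁ (cong +_ e)) ⟩
  m ≡ 0
    ∎
  where
  open EquationalReasoning
  m = posCount P

paritySigned⇔-oneOddNeg : ∀ P → oddNegCount P ≡ 1 → (a b : ℕ) → ms P ≡ a ∷ b ∷ [] →
  ParitySigned P ⇔ (∣ + a - + b ∣ ≤ 1)
paritySigned⇔-oneOddNeg P k≡1 a b ms≡ab = begin
  ParitySigned P          ∼⟨ paritySigned⇔-odd P (cong (_% 2) k≡1) ⟩
  WithinOne (diffEO P)    ≡⟨ cong WithinOne diffEO≡a-b ⟩
  WithinOne (+ a - + b)   ∼⟨ withinOne⇔∣∣≤1 (+ a - + b) ⟩
  ∣ + a - + b ∣ ≤ 1       ∎
  where
  open EquationalReasoning
  x-[y-0]≡x-y : ∀ x y → x - (y - + 0) ≡ x - y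
  x-[y-0]≡x-y = solve-∀
  diffEO≡a-b : diffEO P ≡ + a - + b
  diffEO≡a-b =
    trans (evenSum-oddSum (ms P)) (trans (cong alternatingSum ms≡ab) (x-[y-0]≡x-y (+ a) (+ b)))

theorem4 : (P : SignedPath) →
    ((oddNegCount P % 2 ≡ 1) →
      (ParitySigned P ⇔ (diffEO P ≡ + 1 ⊎ diffEO P ≡ + 0 ⊎ diffEO P ≡ - (+ 1)))) ×
    ((oddNegCount P % 2 ≡ 0) →
      (ParitySigned P ⇔ (diffEO P ≡ + 0 ⊎ diffEO P ≡ - (+ 1) ⊎ diffEO P ≡ - (+ 2)))) ×
    ((oddNegCount P ≡ 0) → (ParitySigned P ⇔ (posCount P ≡ 0))) ×
    ((oddNegCount P ≡ 1) → (a b : ℕ) → ms P ≡ a ∷ b ∷ [] →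
      (ParitySigned P ⇔ (∣ + a - + b ∣ ≤ 1)))
theorem4 P =
  paritySigned⇔-odd P , paritySigned⇔-even P , paritySigned⇔-noOddNeg P , paritySigned⇔-oneOddNeg P
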